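{- For $n\ge1$ let $V_n:=\sum_{w\in\mathcal F_{n,2}}\mathrm{ver}(G(w))$ and $D^{(3)}_n:=\sum_{w\in\mathcal F_{n,2}}\deg_3(G(w))$. Then $$\lim_{n\to\infty}\frac{D^{(3)}_n}{V_n}=\frac{4+\sqrt5}{11}.$$
   Context: $\mathcal F_{n,2}$ is the set of binary words $w=w_1\cdots w_n$ with no two consecutive $1$'s. $P(w)$ is the bargraph polyomino formed by the unit squares $[i-1,i]\times[j-1,j]$, $1\le i\le n$, $1\le j\le w_i+1$. $G(w)$ is the graph whose vertices are the corners of the cells of $P(w)$ and whose edges are the cell sides. $\mathrm{ver}(G)$ is the number of vertices of $G$ and $\deg_3(G)$ the number of vertices of degree $3$. -}

module Defs where

open import Data.Bool using (Bool; true; false; _∧_; _∨_; not; if_then_else_)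
open import Data.Nat using (ℕ; zero; suc; _≤ᵇ_; _≡ᵇ_)
open import Data.List using (List; []; _∷_; concatMap; filterᵇ; length; map; upTo)
open import Data.Nat.ListAction using (sum)
open import Data.Product using (_×_; _,_)
open import Data.Integer using (+_)
open import Data.Rational using (ℚ; _+_; _*_; _-_; _<_; _/_; 0ℚ)
open import Data.Sum using (_⊎_)

-- all binary words of length n (w_1 is the head of the list)
allWords : ℕ → List (List Bool)
allWords zero    = [] ∷ []
allWords (suc n) = concatMap (λ w → (false ∷ w) ∷ (true ∷ w) ∷ []) (allWords n)

noTwoOnes : List Bool → Bool
noTwoOnes []                    = true
noTwoOnes (_ ∷ [])              = true
noTwoOnes (true ∷ true ∷ w)     = false
noTwoOnes (_ ∷ b ∷ w)           = noTwoOnes (b ∷ w)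

F : ℕ → List (List Bool)
F n = filterᵇ noTwoOnes (allWords n)

-- The bargraph P(w): column i (1-indexed) has height w_i + 1.

bit : Bool → ℕ
bit true  = 1
bit false = 0

height : List Bool → ℕ → ℕ
height []      _             = 0
height (_ ∷ _) zero          = 0
height (b ∷ _) (suc zero)    = suc (bit b)
height (_ ∷ w) (suc (suc i)) = height w (suc i)

-- cell i j  is the unit square [i-1,i] × [j-1,j]; it belongs to P(w)
-- iff 1 ≤ i ≤ n and 1 ≤ j ≤ w_i + 1.
cell : List Bool → ℕ → ℕ → Bool
cell w i j = (1 ≤ᵇ i) ∧ ((1 ≤ᵇ j) ∧ (j ≤ᵇ height w i))

-- The graph G(w): vertices = lattice points that are corners of cells,
-- edges = unit segments that are sides of cells.

isVertex : List Bool → ℕ → ℕ → Bool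
isVertex w x y = cell w x y ∨ cell w (suc x) y ∨ cell w x (suc y) ∨ cell w (suc x) (suc y)

hEdge : List Bool → ℕ → ℕ → Bool
hEdge w x y = cell w (suc x) y ∨ cell w (suc x) (suc y)

vEdge : List Bool → ℕ → ℕ → Bool
vEdge w x y = cell w x (suc y) ∨ cell w (suc x) (suc y)

leftEdge : List Bool → ℕ → ℕ → Bool
leftEdge w zero    y = false
leftEdge w (suc x) y = hEdge w x y

downEdge : List Bool → ℕ → ℕ → Bool
downEdge w x zero    = false
downEdge w x (suc y) = vEdge w x y

degree : List Bool → ℕ → ℕ → ℕ
degree w x y = bit (hEdge w x y) Data.Nat.+ bit (leftEdge w x y)
               Data.Nat.+ bit (vEdge w x y) Data.Nat.+ bit (downEdge w x y)

-- A bounding box of lattice points containing all vertices of G(w) for |w| = n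
-- (all corners satisfy 0 ≤ x ≤ n and 0 ≤ y ≤ 2).
box : ℕ → List (ℕ × ℕ)
box n = concatMap (λ x → map (λ y → (x , y)) (upTo 4)) (upTo (suc n))

count : {A : Set} → (A → Bool) → List A → ℕ
count p xs = length (filterᵇ p xs)

ver : List Bool → ℕ
ver w = count (λ { (x , y) → isVertex w x y }) (box (length w))

deg3 : List Bool → ℕ
deg3 w = count (λ { (x , y) → isVertex w x y ∧ (degree w x y ≡ᵇ 3) }) (box (length w))

V : ℕ → ℕ
V n = sum (map ver (F n))

D3 : ℕ → ℕ
D3 n = sum (map deg3 (F n))

Sqrt5Lt : ℚ → Set
Sqrt5Lt a = (0ℚ < a) × ((+ 5 / 1) < a * a)

LtSqrt5 : ℚ → Set
LtSqrt5 b = (b < 0ℚ) ⊎ (b * b < (+ 5 / 1))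

-- |q - (4+√5)/11| < ε, i.e.  q - ε < (4+√5)/11 < q + ε,
-- i.e.  11(q-ε) - 4 < √5 < 11(q+ε) - 4.
CloseToL : ℚ → ℚ → Set
CloseToL q ε = LtSqrt5 ((+ 11 / 1) * (q - ε) - (+ 4 / 1))
             × Sqrt5Lt ((+ 11 / 1) * (q + ε) - (+ 4 / 1))

-- A word of F_{n+2} is 0w with w ∈ F_{n+1} or 10w with w ∈ F_n, and prepending a letter only changes
-- the first two columns of G(w). So V_n and D_n satisfy Fibonacci recurrences with Fibonacci forcing
-- terms, and solving them gives, for n = k + 2, a = F_{k+2} and b = F_{k+3},
--   5 V_n = P := 14(k+3)a + (12k+34)b,    5 D_n = Q := 6(k+3)a + (8k+6)b.
-- With r = 11 Q/P - 4 we get P²(5 - r²) = 880((k+3)²(a² + ab - b²) + 4(k+3)ab + (17k+10)b²), and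
-- Cassini's identity a² + ab - b² = ±1 makes this positive and O(k b²) while P² ≍ k² b². Hence
-- 1 ≤ r < √5 with 5 - r² = O(1/k), i.e. D_n/V_n → (4 + √5)/11. All inequalities are proved in ℕ and
-- transported to ℚ, where √5 only enters through squaring.

module Submission where

open import Defs

module Enumeration where

  open import Data.Bool using (Bool; true; false; not; _∧_; if_then_else_)
  open import Data.Nat
  open import Data.Nat.Properties
  open import Data.Nat.ListAction using (sum)
  open import Data.List using (List; []; _∷_; _++_; concatMap; filterᵇ; length; map; upTo; applyUpTo)
  open import Data.List.Properties using (map-++; map-upTo)
  open import Data.Nat.ListAction.Properties using (sum-++)
  open import Data.Product using (_×_; _,_; proj₁; uncurry)
  open import Function using (_∘_)
  open import Relation.Binary.PropositionalEquality
  open import Data.Nat.Tactic.RingSolver using (solve-∀)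
  open import Algebra.Properties.CommutativeSemigroup +-commutativeSemigroup using (interchange)
  open ≡-Reasoning

  count≡sum-bit : ∀ {A : Set} (p : A → Bool) xs → count p xs ≡ sum (map (bit ∘ p) xs)
  count≡sum-bit p []       = refl
  count≡sum-bit p (x ∷ xs) with p x
  ... | true  = cong suc (count≡sum-bit p xs)
  ... | false = count≡sum-bit p xs

  sum-map-concatMap : ∀ {A B : Set} (f : B → ℕ) (g : A → List B) xs →
    sum (map f (concatMap g xs)) ≡ sum (map (sum ∘ map f ∘ g) xs)
  sum-map-concatMap f g []       = refl
  sum-map-concatMap f g (x ∷ xs) = begin
    sum (map f (g x ++ concatMap g xs))               ≡⟨ cong sum (map-++ f (g x) _) ⟩
    sum (map f (g x) ++ map f (concatMap g xs))       ≡⟨ sum-++ (map f (g x)) _ ⟩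
    sum (map f (g x)) + sum (map f (concatMap g xs))  ≡⟨ cong (sum (map f (g x)) +_) (sum-map-concatMap f g xs) ⟩
    sum (map f (g x)) + sum (map (sum ∘ map f ∘ g) xs) ∎

  sum-applyUpTo-cong : ∀ {f g : ℕ → ℕ} → (∀ x → f x ≡ g x) → ∀ n → sum (applyUpTo f n) ≡ sum (applyUpTo g n)
  sum-applyUpTo-cong f≗g zero    = refl
  sum-applyUpTo-cong f≗g (suc n) = cong₂ _+_ (f≗g 0) (sum-applyUpTo-cong (f≗g ∘ suc) n)

  sumWhere : {A : Set} → (A → Bool) → (A → ℕ) → List A → ℕ
  sumWhere p g []       = 0
  sumWhere p g (x ∷ xs) = (if p x then g x else 0) + sumWhere p g xs

  sum-map-filterᵇ : ∀ {A : Set} (p : A → Bool) (g : A → ℕ) xs → sum (map g (filterᵇ p xs)) ≡ sumWhere p g xs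
  sum-map-filterᵇ p g []       = refl
  sum-map-filterᵇ p g (x ∷ xs) with p x
  ... | true  = cong (g x +_) (sum-map-filterᵇ p g xs)
  ... | false = sum-map-filterᵇ p g xs

  sumWhere-concatMap : ∀ {A B : Set} (p : B → Bool) (g : B → ℕ) (f h : A → B) xs →
    sumWhere p g (concatMap (λ x → f x ∷ h x ∷ []) xs) ≡ sumWhere (p ∘ f) (g ∘ f) xs + sumWhere (p ∘ h) (g ∘ h) xs
  sumWhere-concatMap p g f h []       = refl
  sumWhere-concatMap p g f h (x ∷ xs) = begin
    fx + (hx + sumWhere p g (concatMap (λ x → f x ∷ h x ∷ []) xs))          ≡⟨ cong (λ s → fx + (hx + s)) (sumWhere-concatMap p g f h xs) ⟩
    fx + (hx + (sumWhere (p ∘ f) (g ∘ f) xs + sumWhere (p ∘ h) (g ∘ h) xs)) ≡⟨ +-assoc fx hx _ ⟨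
    fx + hx + (sumWhere (p ∘ f) (g ∘ f) xs + sumWhere (p ∘ h) (g ∘ h) xs)   ≡⟨ interchange fx hx _ _ ⟩
    fx + sumWhere (p ∘ f) (g ∘ f) xs + (hx + sumWhere (p ∘ h) (g ∘ h) xs)   ∎
    where
    fx = if p (f x) then g (f x) else 0
    hx = if p (h x) then g (h x) else 0

  sumWhere-congᵖ : ∀ {A : Set} {p q : A → Bool} (g : A → ℕ) → (∀ x → p x ≡ q x) → ∀ xs → sumWhere p g xs ≡ sumWhere q g xs
  sumWhere-congᵖ g p≗q []       = refl
  sumWhere-congᵖ g p≗q (x ∷ xs) rewrite p≗q x = cong (_ +_) (sumWhere-congᵖ g p≗q xs)

  sumWhere-none : ∀ {A : Set} {p : A → Bool} (g : A → ℕ) → (∀ x → p x ≡ false) → ∀ xs → sumWhere p g xs ≡ 0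
  sumWhere-none g ¬p []       = refl
  sumWhere-none g ¬p (x ∷ xs) rewrite ¬p x = sumWhere-none g ¬p xs

  sumWhere-+ : ∀ {A : Set} (p : A → Bool) (g h : A → ℕ) xs →
    sumWhere p (λ x → g x + h x) xs ≡ sumWhere p g xs + sumWhere p h xs
  sumWhere-+ p g h []       = refl
  sumWhere-+ p g h (x ∷ xs) with p x
  ... | true  = trans (cong (g x + h x +_) (sumWhere-+ p g h xs)) (interchange (g x) (h x) _ _)
  ... | false = sumWhere-+ p g h xs

  sumWhere-* : ∀ {A : Set} (p : A → Bool) c (g : A → ℕ) xs → sumWhere p (λ x → c * g x) xs ≡ c * sumWhere p g xs
  sumWhere-* p c g []       = sym (*-zeroʳ c)
  sumWhere-* p c g (x ∷ xs) with p x
  ... | true  = trans (cong (c * g x +_) (sumWhere-* p c g xs)) (sym (*-distribˡ-+ c (g x) _))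
  ... | false = sumWhere-* p c g xs

  sumWhere-const : ∀ {A : Set} (p : A → Bool) c xs → sumWhere p (λ _ → c) xs ≡ c * sumWhere p (λ _ → 1) xs
  sumWhere-const p c []       = sym (*-zeroʳ c)
  sumWhere-const p c (x ∷ xs) with p x
  ... | true  = trans (cong (c +_) (sumWhere-const p c xs)) (sym (*-suc c _))
  ... | false = sumWhere-const p c xs

  columnCount : (ℕ → ℕ → Bool) → ℕ → ℕ
  columnCount P x = sum (map (λ y → bit (P x y)) (upTo 4))

  count-box : ∀ P n → count (uncurry P) (box n) ≡ sum (applyUpTo (columnCount P) (suc n))
  count-box P n = begin
    count (uncurry P) (box n)                 ≡⟨ count≡sum-bit (uncurry P) (box n) ⟩
    sum (map (bit ∘ uncurry P) (box n))       ≡⟨ sum-map-concatMap (bit ∘ uncurry P) (λ x → map (λ y → (x , y)) (upTo 4)) (upTo (suc n)) ⟩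
    sum (map (columnCount P) (upTo (suc n)))  ≡⟨ cong sum (map-upTo (columnCount P) (suc n)) ⟩
    sum (applyUpTo (columnCount P) (suc n))   ∎

  count-box-shift : ∀ P Q n → (∀ x → columnCount P (2 + x) ≡ columnCount Q (1 + x)) →
    count (uncurry P) (box (suc n)) + columnCount Q 0 ≡
    columnCount P 0 + columnCount P 1 + count (uncurry Q) (box n)
  count-box-shift P Q n shift = begin
    count (uncurry P) (box (suc n)) + Q₀                            ≡⟨ cong (_+ Q₀) (count-box P (suc n)) ⟩
    P₀ + (P₁ + sum (applyUpTo (columnCount P ∘ suc ∘ suc) n)) + Q₀  ≡⟨ cong (λ s → P₀ + (P₁ + s) + Q₀) (sum-applyUpTo-cong shift n) ⟩
    P₀ + (P₁ + S) + Q₀                                              ≡⟨ rearrange P₀ P₁ S Q₀ ⟩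
    P₀ + P₁ + (Q₀ + S)                                              ≡⟨ cong (P₀ + P₁ +_) (count-box Q n) ⟨
    P₀ + P₁ + count (uncurry Q) (box n)                             ∎
    where
    P₀ = columnCount P 0
    P₁ = columnCount P 1
    Q₀ = columnCount Q 0
    S = sum (applyUpTo (columnCount Q ∘ suc) n)
    rearrange : ∀ a b c d → a + (b + c) + d ≡ a + b + (d + c)
    rearrange = solve-∀

  isDeg3Vertex : List Bool → ℕ → ℕ → Bool
  isDeg3Vertex w x y = isVertex w x y ∧ (degree w x y ≡ᵇ 3)

  -- Columns x ≥ 2 of G(b ∷ c ∷ w) evaluate to columns x ≥ 1 of G(c ∷ w), and once the leading letters
  -- are known the counts in the first columns evaluate to numerals: prepending a letter adds a constant.
  ver-shift : ∀ b c w → ver (b ∷ c ∷ w) + columnCount (isVertex (c ∷ w)) 0 ≡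
    columnCount (isVertex (b ∷ c ∷ w)) 0 + columnCount (isVertex (b ∷ c ∷ w)) 1 + ver (c ∷ w)
  ver-shift b c w = count-box-shift (isVertex (b ∷ c ∷ w)) (isVertex (c ∷ w)) (length (c ∷ w)) (λ _ → refl)

  deg3-shift : ∀ b c w → deg3 (b ∷ c ∷ w) + columnCount (isDeg3Vertex (c ∷ w)) 0 ≡
    columnCount (isDeg3Vertex (b ∷ c ∷ w)) 0 + columnCount (isDeg3Vertex (b ∷ c ∷ w)) 1 + deg3 (c ∷ w)
  deg3-shift b c w = count-box-shift (isDeg3Vertex (b ∷ c ∷ w)) (isDeg3Vertex (c ∷ w)) (length (c ∷ w)) (λ _ → refl)

  leadingZero : List Bool → ℕ
  leadingZero []      = 0
  leadingZero (b ∷ _) = bit (not b)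

  m+o≡n+o+p⇒m≡n+p : ∀ {m p} n o → m + o ≡ n + o + p → m ≡ n + p
  m+o≡n+o+p⇒m≡n+p {m} {p} n o eq = +-cancelʳ-≡ o m (n + p) (trans eq (begin
    n + o + p   ≡⟨ +-assoc n o p ⟩
    n + (o + p) ≡⟨ cong (n +_) (+-comm o p) ⟩
    n + (p + o) ≡⟨ +-assoc n p o ⟨
    n + p + o   ∎))

  ver-false∷ : ∀ c w → ver (false ∷ c ∷ w) ≡ 2 + ver (c ∷ w)
  ver-false∷ false w = m+o≡n+o+p⇒m≡n+p 2 2 (ver-shift false false w)
  ver-false∷ true  w = m+o≡n+o+p⇒m≡n+p 2 3 (ver-shift false true w)

  ver-true∷false∷ : ∀ w → ver (true ∷ false ∷ w) ≡ 4 + ver (false ∷ w)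
  ver-true∷false∷ w = m+o≡n+o+p⇒m≡n+p 4 2 (ver-shift true false w)

  deg3-false∷ : ∀ c w → deg3 (false ∷ c ∷ w) ≡ 2 * leadingZero (c ∷ w) + deg3 (c ∷ w)
  deg3-false∷ false w = m+o≡n+o+p⇒m≡n+p 2 0 (deg3-shift false false w)
  deg3-false∷ true  w = m+o≡n+o+p⇒m≡n+p 0 1 (deg3-shift false true w)

  deg3-true∷false∷ : ∀ w → deg3 (true ∷ false ∷ w) ≡ 2 + deg3 (false ∷ w)
  deg3-true∷false∷ w = m+o≡n+o+p⇒m≡n+p 2 0 (deg3-shift true false w)

  fib : ℕ → ℕ
  fib 0             = 0
  fib 1             = 1
  fib (suc (suc n)) = fib (suc n) + fib n

  Recurrence : (ℕ → ℕ) → (ℕ → ℕ) → Set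
  Recurrence g x = ∀ n → x (2 + n) ≡ x (1 + n) + x n + g n

  recurrence-unique : ∀ {g x y} → Recurrence g x → Recurrence g y → x 0 ≡ y 0 → x 1 ≡ y 1 → ∀ n → x n ≡ y n
  recurrence-unique {g} {x} {y} rec-x rec-y x₀≡y₀ x₁≡y₁ n = proj₁ (consecutive n)
    where
    consecutive : ∀ n → x n ≡ y n × x (1 + n) ≡ y (1 + n)
    consecutive zero    = x₀≡y₀ , x₁≡y₁
    consecutive (suc n) with consecutive n
    ... | xₙ≡yₙ , xₙ₊₁≡yₙ₊₁ = xₙ₊₁≡yₙ₊₁ , (begin
      x (2 + n)                 ≡⟨ rec-x n ⟩
      x (1 + n) + x n + g n     ≡⟨ cong₂ (λ u v → u + v + g n) xₙ₊₁≡yₙ₊₁ xₙ≡yₙ ⟩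
      y (1 + n) + y n + g n     ≡⟨ rec-y n ⟨
      y (2 + n)                 ∎)

  recurrence-* : ∀ {g x} c → Recurrence g x → Recurrence (λ n → c * g n) (λ n → c * x n)
  recurrence-* {g} {x} c rec-x n = begin
    c * x (2 + n)                             ≡⟨ cong (c *_) (rec-x n) ⟩
    c * (x (1 + n) + x n + g n)               ≡⟨ *-distribˡ-+ c (x (1 + n) + x n) (g n) ⟩
    c * (x (1 + n) + x n) + c * g n           ≡⟨ cong (_+ c * g n) (*-distribˡ-+ c (x (1 + n)) (x n)) ⟩
    c * x (1 + n) + c * x n + c * g n         ∎

  sumF : ℕ → (List Bool → ℕ) → ℕ
  sumF n g = sumWhere noTwoOnes g (allWords n)

  V≡sumF-ver : ∀ n → V n ≡ sumF n ver
  V≡sumF-ver n = sum-map-filterᵇ noTwoOnes ver (allWords n)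

  D3≡sumF-deg3 : ∀ n → D3 n ≡ sumF n deg3
  D3≡sumF-deg3 n = sum-map-filterᵇ noTwoOnes deg3 (allWords n)

  sumWhere-allWords-suc : ∀ (p : List Bool → Bool) g n → sumWhere p g (allWords (suc n)) ≡
    sumWhere (p ∘ (false ∷_)) (g ∘ (false ∷_)) (allWords n) + sumWhere (p ∘ (true ∷_)) (g ∘ (true ∷_)) (allWords n)
  sumWhere-allWords-suc p g n = sumWhere-concatMap p g (false ∷_) (true ∷_) (allWords n)

  sumWhere-allWords-cong : ∀ n (p : List Bool → Bool) {g h} → (∀ w → length w ≡ n → g w ≡ h w) →
    sumWhere p g (allWords n) ≡ sumWhere p h (allWords n)
  sumWhere-allWords-cong zero    p g≗h = cong (λ v → (if p [] then v else 0) + 0) (g≗h [] refl)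
  sumWhere-allWords-cong (suc n) p {g} {h} g≗h = begin
    sumWhere p g (allWords (suc n))                                                      ≡⟨ sumWhere-allWords-suc p g n ⟩
    sumWhere (p ∘ (false ∷_)) (g ∘ (false ∷_)) (allWords n) + sumWhere (p ∘ (true ∷_)) (g ∘ (true ∷_)) (allWords n)
      ≡⟨ cong₂ _+_ (sumWhere-allWords-cong n (p ∘ (false ∷_)) (λ w → g≗h (false ∷ w) ∘ cong suc))
                   (sumWhere-allWords-cong n (p ∘ (true ∷_)) (λ w → g≗h (true ∷ w) ∘ cong suc)) ⟩
    sumWhere (p ∘ (false ∷_)) (h ∘ (false ∷_)) (allWords n) + sumWhere (p ∘ (true ∷_)) (h ∘ (true ∷_)) (allWords n)
      ≡⟨ sumWhere-allWords-suc p h n ⟨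
    sumWhere p h (allWords (suc n))                                                      ∎

  noTwoOnes-false∷ : ∀ w → noTwoOnes (false ∷ w) ≡ noTwoOnes w
  noTwoOnes-false∷ []      = refl
  noTwoOnes-false∷ (_ ∷ _) = refl

  sumF-suc : ∀ n g → sumF (suc n) g ≡
    sumF n (g ∘ (false ∷_)) + sumWhere (noTwoOnes ∘ (true ∷_)) (g ∘ (true ∷_)) (allWords n)
  sumF-suc n g = trans (sumWhere-allWords-suc noTwoOnes g n)
    (cong (_+ sumWhere (noTwoOnes ∘ (true ∷_)) (g ∘ (true ∷_)) (allWords n))
          (sumWhere-congᵖ (g ∘ (false ∷_)) noTwoOnes-false∷ (allWords n)))

  sumWhere-true∷-allWords-suc : ∀ n g →
    sumWhere (noTwoOnes ∘ (true ∷_)) g (allWords (suc n)) ≡ sumF n (g ∘ (false ∷_))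
  sumWhere-true∷-allWords-suc n g = begin
    sumWhere (noTwoOnes ∘ (true ∷_)) g (allWords (suc n))     ≡⟨ sumWhere-allWords-suc (noTwoOnes ∘ (true ∷_)) g n ⟩
    sumWhere (noTwoOnes ∘ (false ∷_)) (g ∘ (false ∷_)) (allWords n) + sumWhere (λ _ → false) (g ∘ (true ∷_)) (allWords n)
      ≡⟨ cong₂ _+_ (sumWhere-congᵖ (g ∘ (false ∷_)) noTwoOnes-false∷ (allWords n))
                   (sumWhere-none (g ∘ (true ∷_)) (λ _ → refl) (allWords n)) ⟩
    sumF n (g ∘ (false ∷_)) + 0                               ≡⟨ +-identityʳ _ ⟩
    sumF n (g ∘ (false ∷_))                                   ∎

  sumF-suc-suc : ∀ n g → sumF (2 + n) g ≡ sumF (1 + n) (g ∘ (false ∷_)) + sumF n (λ w → g (true ∷ false ∷ w))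
  sumF-suc-suc n g = trans (sumF-suc (1 + n) g)
    (cong (sumF (1 + n) (g ∘ (false ∷_)) +_) (sumWhere-true∷-allWords-suc n (g ∘ (true ∷_))))

  sumF-one : ∀ n → sumF n (λ _ → 1) ≡ fib (2 + n)
  sumF-one = recurrence-unique {g = λ _ → 0}
    (λ n → trans (sumF-suc-suc n (λ _ → 1)) (sym (+-identityʳ _)))
    (λ n → sym (+-identityʳ _))
    refl refl

  sumF-const : ∀ n c → sumF n (λ _ → c) ≡ c * fib (2 + n)
  sumF-const n c = trans (sumWhere-const noTwoOnes c (allWords n)) (cong (c *_) (sumF-one n))

  sumF-+ : ∀ n g h → sumF n (λ w → g w + h w) ≡ sumF n g + sumF n h
  sumF-+ n g h = sumWhere-+ noTwoOnes g h (allWords n)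

  sumF-affine : ∀ n c g → sumF n (λ w → c + g w) ≡ c * fib (2 + n) + sumF n g
  sumF-affine n c g = trans (sumF-+ n (λ _ → c) g) (cong (_+ sumF n g) (sumF-const n c))

  sumF-leadingZero : ∀ n → sumF (suc n) leadingZero ≡ fib (2 + n)
  sumF-leadingZero n = begin
    sumF (suc n) leadingZero                                                     ≡⟨ sumF-suc n leadingZero ⟩
    sumF n (λ _ → 1) + sumWhere (noTwoOnes ∘ (true ∷_)) (λ _ → 0) (allWords n)   ≡⟨ cong₂ _+_ (sumF-one n) (sumWhere-const _ 0 (allWords n)) ⟩
    fib (2 + n) + 0                                                              ≡⟨ +-identityʳ _ ⟩
    fib (2 + n)                                                                  ∎

  V-recurrence : Recurrence (λ k → 2 * fib (5 + k) + 6 * fib (4 + k)) (λ k → V (2 + k))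
  V-recurrence k = begin
    V (4 + k)                                                                      ≡⟨ V≡sumF-ver (4 + k) ⟩
    sumF (4 + k) ver                                                               ≡⟨ sumF-suc-suc (2 + k) ver ⟩
    sumF (3 + k) (ver ∘ (false ∷_)) + sumF (2 + k) (λ w → ver (true ∷ false ∷ w))  ≡⟨ cong₂ _+_
      (sumWhere-allWords-cong (3 + k) noTwoOnes ver-after-false)
      (sumWhere-allWords-cong (2 + k) noTwoOnes ver-after-true-false) ⟩
    sumF (3 + k) (λ w → 2 + ver w) + sumF (2 + k) (λ w → 6 + ver w)                ≡⟨ cong₂ _+_ (sumF-affine (3 + k) 2 ver) (sumF-affine (2 + k) 6 ver) ⟩
    (2 * fib (5 + k) + sumF (3 + k) ver) + (6 * fib (4 + k) + sumF (2 + k) ver)    ≡⟨ cong₂ (λ u v → (2 * fib (5 + k) + u) + (6 * fib (4 + k) + v))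
                                                                                           (V≡sumF-ver (3 + k)) (V≡sumF-ver (2 + k)) ⟨
    (2 * fib (5 + k) + V (3 + k)) + (6 * fib (4 + k) + V (2 + k))                  ≡⟨ rearrange (2 * fib (5 + k)) (V (3 + k)) (6 * fib (4 + k)) (V (2 + k)) ⟩
    V (3 + k) + V (2 + k) + (2 * fib (5 + k) + 6 * fib (4 + k))                    ∎
    where
    ver-after-false : ∀ w → length w ≡ 3 + k → ver (false ∷ w) ≡ 2 + ver w
    ver-after-false (c ∷ w) _ = ver-false∷ c w
    ver-after-true-false : ∀ w → length w ≡ 2 + k → ver (true ∷ false ∷ w) ≡ 6 + ver w
    ver-after-true-false (c ∷ w) _ = trans (ver-true∷false∷ (c ∷ w)) (cong (4 +_) (ver-false∷ c w))
    rearrange : ∀ a b c d → (a + b) + (c + d) ≡ b + d + (a + c)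
    rearrange = solve-∀

  sumF-deg3-after-false : ∀ n → sumF (suc n) (λ w → 2 * leadingZero w + deg3 w) ≡ 2 * fib (2 + n) + D3 (suc n)
  sumF-deg3-after-false n = begin
    sumF (suc n) (λ w → 2 * leadingZero w + deg3 w)               ≡⟨ sumF-+ (suc n) (λ w → 2 * leadingZero w) deg3 ⟩
    sumF (suc n) (λ w → 2 * leadingZero w) + sumF (suc n) deg3    ≡⟨ cong₂ _+_ (sumWhere-* noTwoOnes 2 leadingZero (allWords (suc n)))
                                                                                (sym (D3≡sumF-deg3 (suc n))) ⟩
    2 * sumF (suc n) leadingZero + D3 (suc n)                     ≡⟨ cong (λ s → 2 * s + D3 (suc n)) (sumF-leadingZero n) ⟩
    2 * fib (2 + n) + D3 (suc n)                                  ∎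

  D3-recurrence : Recurrence (λ k → 4 * fib (4 + k) + 2 * fib (3 + k)) (λ k → D3 (2 + k))
  D3-recurrence k = begin
    D3 (4 + k)                                                                          ≡⟨ D3≡sumF-deg3 (4 + k) ⟩
    sumF (4 + k) deg3                                                                   ≡⟨ sumF-suc-suc (2 + k) deg3 ⟩
    sumF (3 + k) (deg3 ∘ (false ∷_)) + sumF (2 + k) (λ w → deg3 (true ∷ false ∷ w))     ≡⟨ cong₂ _+_
      (sumWhere-allWords-cong (3 + k) noTwoOnes deg3-after-false)
      (sumWhere-allWords-cong (2 + k) noTwoOnes deg3-after-true-false) ⟩
    sumF (3 + k) (λ w → 2 * leadingZero w + deg3 w)
      + sumF (2 + k) (λ w → 2 + (2 * leadingZero w + deg3 w))                           ≡⟨ cong₂ _+_ (sumF-deg3-after-false (2 + k))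
                                                                                                (sumF-affine (2 + k) 2 (λ w → 2 * leadingZero w + deg3 w)) ⟩
    (2 * fib (4 + k) + D3 (3 + k))
      + (2 * fib (4 + k) + sumF (2 + k) (λ w → 2 * leadingZero w + deg3 w))             ≡⟨ cong (λ s → (2 * fib (4 + k) + D3 (3 + k)) + (2 * fib (4 + k) + s))
                                                                                                (sumF-deg3-after-false (1 + k)) ⟩
    (2 * fib (4 + k) + D3 (3 + k)) + (2 * fib (4 + k) + (2 * fib (3 + k) + D3 (2 + k))) ≡⟨ rearrange (fib (4 + k)) (fib (3 + k)) (D3 (3 + k)) (D3 (2 + k)) ⟩
    D3 (3 + k) + D3 (2 + k) + (4 * fib (4 + k) + 2 * fib (3 + k))                       ∎
    where
    deg3-after-false : ∀ w → length w ≡ 3 + k → deg3 (false ∷ w) ≡ 2 * leadingZero w + deg3 w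
    deg3-after-false (c ∷ w) _ = deg3-false∷ c w
    deg3-after-true-false : ∀ w → length w ≡ 2 + k → deg3 (true ∷ false ∷ w) ≡ 2 + (2 * leadingZero w + deg3 w)
    deg3-after-true-false (c ∷ w) _ = trans (deg3-true∷false∷ (c ∷ w)) (cong (2 +_) (deg3-false∷ c w))
    rearrange : ∀ a b x y → (2 * a + x) + (2 * a + (2 * b + y)) ≡ x + y + (4 * a + 2 * b)
    rearrange = solve-∀

  vertexForm : ℕ → ℕ → ℕ → ℕ
  vertexForm k a b = 14 * (k + 3) * a + (12 * k + 34) * b

  deg3Form : ℕ → ℕ → ℕ → ℕ
  deg3Form k a b = 6 * (k + 3) * a + (8 * k + 6) * b

  five-V : ∀ k → 5 * V (2 + k) ≡ vertexForm k (fib (2 + k)) (fib (3 + k))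
  five-V = recurrence-unique (recurrence-* {x = λ k → V (2 + k)} 5 V-recurrence) closed-form-recurrence refl refl
    where
    closed-form-recurrence : Recurrence (λ k → 5 * (2 * fib (5 + k) + 6 * fib (4 + k)))
                                        (λ k → vertexForm k (fib (2 + k)) (fib (3 + k)))
    -- For a = fib (2 + k) and b = fib (3 + k), fib (4 + k) and fib (5 + k) evaluate to b + a and b + a + b.
    closed-form-recurrence k = identity k (fib (2 + k)) (fib (3 + k))
      where
      identity : ∀ k a b → 14 * (2 + k + 3) * (b + a) + (12 * (2 + k) + 34) * (b + a + b) ≡
        14 * (1 + k + 3) * b + (12 * (1 + k) + 34) * (b + a) + (14 * (k + 3) * a + (12 * k + 34) * b)
          + 5 * (2 * (b + a + b) + 6 * (b + a))
      identity = solve-∀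

  five-D3 : ∀ k → 5 * D3 (2 + k) ≡ deg3Form k (fib (2 + k)) (fib (3 + k))
  five-D3 = recurrence-unique (recurrence-* {x = λ k → D3 (2 + k)} 5 D3-recurrence) closed-form-recurrence refl refl
    where
    closed-form-recurrence : Recurrence (λ k → 5 * (4 * fib (4 + k) + 2 * fib (3 + k)))
                                        (λ k → deg3Form k (fib (2 + k)) (fib (3 + k)))
    closed-form-recurrence k = identity k (fib (2 + k)) (fib (3 + k))
      where
      identity : ∀ k a b → 6 * (2 + k + 3) * (b + a) + (8 * (2 + k) + 6) * (b + a + b) ≡
        6 * (1 + k + 3) * b + (8 * (1 + k) + 6) * (b + a) + (6 * (k + 3) * a + (8 * k + 6) * b)
          + 5 * (4 * (b + a) + 2 * b)
      identity = solve-∀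

module Estimates where

  open Enumeration using (fib; vertexForm; deg3Form; five-V; five-D3)
  open import Data.Nat
  open import Data.Nat.Properties
  open import Data.Nat.Tactic.RingSolver using (solve-∀)
  open import Data.Product using (_×_; _,_)
  open import Data.Sum using (_⊎_; inj₁; inj₂)
  open import Relation.Binary.PropositionalEquality

  fib-mono : ∀ n → fib (1 + n) ≤ fib (2 + n)
  fib-mono n = m≤m+n (fib (1 + n)) (fib n)

  fib-pos : ∀ n → 1 ≤ fib (1 + n)
  fib-pos zero    = s≤s z≤n
  fib-pos (suc n) = ≤-trans (fib-pos n) (fib-mono n)

  fib-linear : ∀ n → 2 + n ≤ fib (3 + n)
  fib-linear zero    = s≤s (s≤s z≤n)
  fib-linear (suc n) = ≤-trans (≤-reflexive (+-comm 1 (2 + n))) (+-mono-≤ (fib-linear n) (fib-pos (1 + n)))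

  cassini : ∀ n → let a = fib n; b = fib (1 + n) in
    b * b ≡ a * a + a * b + 1 ⊎ a * a + a * b ≡ b * b + 1
  cassini zero = inj₁ refl
  cassini (suc n) with cassini n
  ... | inj₁ eq = inj₂ (begin
    b * b + b * (b + a)                  ≡⟨ expand a b ⟩
    b * b + b * a + b * b                ≡⟨ cong (b * b + b * a +_) eq ⟩
    b * b + b * a + (a * a + a * b + 1)  ≡⟨ collect a b ⟩
    (b + a) * (b + a) + 1                ∎)
    where
    open ≡-Reasoning
    a = fib n
    b = fib (1 + n)
    expand : ∀ a b → b * b + b * (b + a) ≡ b * b + b * a + b * b
    expand = solve-∀
    collect : ∀ a b → b * b + b * a + (a * a + a * b + 1) ≡ (b + a) * (b + a) + 1
    collect = solve-∀
  ... | inj₂ eq = inj₁ (begin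
    (b + a) * (b + a)                ≡⟨ expand a b ⟩
    b * b + b * a + (a * a + a * b)  ≡⟨ cong (b * b + b * a +_) eq ⟩
    b * b + b * a + (b * b + 1)      ≡⟨ collect a b ⟩
    b * b + b * (b + a) + 1          ∎)
    where
    open ≡-Reasoning
    a = fib n
    b = fib (1 + n)
    expand : ∀ a b → (b + a) * (b + a) ≡ b * b + b * a + (a * a + a * b)
    expand = solve-∀
    collect : ∀ a b → b * b + b * a + (b * b + 1) ≡ b * b + b * (b + a) + 1
    collect = solve-∀

  cassini-upper : ∀ n → let a = fib n; b = fib (1 + n) in b * b ≤ a * a + a * b + 1
  cassini-upper n with cassini n
  ... | inj₁ eq = ≤-reflexive eq
  ... | inj₂ eq = ≤-trans (m≤m+n _ 2) (≤-reflexive (trans (sym (+-assoc _ 1 1)) (cong (_+ 1) (sym eq))))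

  cassini-lower : ∀ n → let a = fib n; b = fib (1 + n) in a * a + a * b ≤ b * b + 1
  cassini-lower n with cassini n
  ... | inj₁ eq = ≤-trans (m≤m+n _ 1) (≤-trans (≤-reflexive (sym eq)) (m≤m+n _ 1))
  ... | inj₂ eq = ≤-reflexive eq

  five-vertexForm≤eleven-deg3Form : ∀ k a b → 5 ≤ k → a ≤ b → 5 * vertexForm k a b ≤ 11 * deg3Form k a b
  five-vertexForm≤eleven-deg3Form k a b 5≤k a≤b with m≤n⇒∃[o]m+o≡n 5≤k | m≤n⇒∃[o]m+o≡n a≤b
  ... | j , refl | d , refl = ≤-trans (m≤m+n _ _) (≤-reflexive (identity j a d))
    where
    identity : ∀ j a d → 5 * (14 * (5 + j + 3) * a + (12 * (5 + j) + 34) * (a + d)) + ((24 * j + 4) * a + (28 * j + 36) * d)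
                       ≡ 11 * (6 * (5 + j + 3) * a + (8 * (5 + j) + 6) * (a + d))
    identity = solve-∀

  -- gap-identity says 5P² - (11Q - 4P)² = 880 (excess - deficit), stated without subtraction.
  excess : ℕ → ℕ → ℕ → ℕ
  excess k a b = (k + 3) * (k + 3) * (a * a + a * b) + 4 * (k + 3) * (a * b) + (17 * k + 10) * (b * b)

  deficit : ℕ → ℕ → ℕ
  deficit k b = (k + 3) * (k + 3) * (b * b)

  gap-identity : ∀ k a b → let P = vertexForm k a b; Q = deg3Form k a b in
    5 * (P * P) + 88 * Q * P + 880 * deficit k b ≡ 121 * Q * Q + 16 * (P * P) + 880 * excess k a b
  gap-identity = identity
    where
    identity : ∀ k a b → let P = 14 * (k + 3) * a + (12 * k + 34) * b; Q = 6 * (k + 3) * a + (8 * k + 6) * b in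
      5 * (P * P) + 88 * Q * P + 880 * ((k + 3) * (k + 3) * (b * b)) ≡
      121 * Q * Q + 16 * (P * P) + 880 * ((k + 3) * (k + 3) * (a * a + a * b) + 4 * (k + 3) * (a * b) + (17 * k + 10) * (b * b))
    identity = solve-∀

  [k+3]²≤4b² : ∀ {k b} → 2 + k ≤ b → (k + 3) * (k + 3) ≤ 4 * (b * b)
  [k+3]²≤4b² {k} {b} 2+k≤b = begin
    (k + 3) * (k + 3)   ≤⟨ *-mono-≤ k+3≤b+b k+3≤b+b ⟩
    (b + b) * (b + b)   ≡⟨ double-square b ⟩
    4 * (b * b)         ∎
    where
    open ≤-Reasoning
    k+3≤b+b : k + 3 ≤ b + b
    k+3≤b+b = ≤-trans (≤-reflexive (+-comm k 3)) (+-mono-≤ (≤-trans (s≤s z≤n) 2+k≤b) 2+k≤b)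
    double-square : ∀ b → (b + b) * (b + b) ≡ 4 * (b * b)
    double-square = solve-∀

  deficit<excess : ∀ k a b → 2 + k ≤ b → b * b ≤ a * a + a * b + 1 → deficit k b < excess k a b
  deficit<excess k a b 2+k≤b cassini = begin-strict
    (k + 3) * (k + 3) * (b * b)                           ≤⟨ *-monoʳ-≤ ((k + 3) * (k + 3)) cassini ⟩
    (k + 3) * (k + 3) * (a * a + a * b + 1)               ≡⟨ split-off-one k (a * a + a * b) ⟩
    S + (k + 3) * (k + 3)                                 ≤⟨ +-monoʳ-≤ S ([k+3]²≤4b² 2+k≤b) ⟩
    S + 4 * (b * b)                                       <⟨ m<m+n (S + 4 * (b * b)) rest-pos ⟩
    S + 4 * (b * b) + ((6 + 17 * k) * (b * b) + 4 * (k + 3) * (a * b))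
                                                          ≡⟨ regroup k a b ⟩
    excess k a b                                          ∎
    where
    open ≤-Reasoning
    S = (k + 3) * (k + 3) * (a * a + a * b)
    1≤b : 1 ≤ b
    1≤b = ≤-trans (s≤s z≤n) 2+k≤b
    rest-pos : 0 < (6 + 17 * k) * (b * b) + 4 * (k + 3) * (a * b)
    rest-pos = ≤-trans (*-mono-≤ {1} {6 + 17 * k} (s≤s z≤n) (*-mono-≤ 1≤b 1≤b)) (m≤m+n _ _)
    split-off-one : ∀ k x → (k + 3) * (k + 3) * (x + 1) ≡ (k + 3) * (k + 3) * x + (k + 3) * (k + 3)
    split-off-one = solve-∀
    regroup : ∀ k a b → (k + 3) * (k + 3) * (a * a + a * b) + 4 * (b * b) + ((6 + 17 * k) * (b * b) + 4 * (k + 3) * (a * b))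
                      ≡ (k + 3) * (k + 3) * (a * a + a * b) + 4 * (k + 3) * (a * b) + (17 * k + 10) * (b * b)
    regroup = solve-∀

  excess≤deficit+ : ∀ k a b → a ≤ b → 2 + k ≤ b → a * a + a * b ≤ b * b + 1 →
    excess k a b ≤ deficit k b + (21 * k + 26) * (b * b)
  excess≤deficit+ k a b a≤b 2+k≤b cassini = begin
    excess k a b                                                    ≤⟨ +-monoˡ-≤ ((17 * k + 10) * (b * b))
                                                                         (+-mono-≤ (*-monoʳ-≤ ((k + 3) * (k + 3)) cassini)
                                                                                   (*-monoʳ-≤ (4 * (k + 3)) (*-monoˡ-≤ b a≤b))) ⟩
    (k + 3) * (k + 3) * (b * b + 1) + 4 * (k + 3) * (b * b) + (17 * k + 10) * (b * b)
                                                                    ≡⟨ collect k b ⟩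
    deficit k b + (k + 3) * (k + 3) + (21 * k + 22) * (b * b)       ≤⟨ +-monoˡ-≤ ((21 * k + 22) * (b * b)) (+-monoʳ-≤ (deficit k b) ([k+3]²≤4b² 2+k≤b)) ⟩
    deficit k b + 4 * (b * b) + (21 * k + 22) * (b * b)             ≡⟨ merge (deficit k b) k (b * b) ⟩
    deficit k b + (21 * k + 26) * (b * b)                           ∎
    where
    open ≤-Reasoning
    collect : ∀ k b → (k + 3) * (k + 3) * (b * b + 1) + 4 * (k + 3) * (b * b) + (17 * k + 10) * (b * b)
                    ≡ (k + 3) * (k + 3) * (b * b) + (k + 3) * (k + 3) + (21 * k + 22) * (b * b)
    collect = solve-∀
    merge : ∀ d k x → d + 4 * x + (21 * k + 22) * x ≡ d + (21 * k + 26) * x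
    merge = solve-∀

  coefficient-margin : ∀ m k → 6 * m ≤ k → 40 * m * (21 * k + 26) < (12 * k + 34) * (12 * k + 34)
  coefficient-margin m k 6m≤k = *-cancelˡ-< 6 (40 * m * (21 * k + 26)) ((12 * k + 34) * (12 * k + 34)) scaled
    where
    open ≤-Reasoning
    reassociate : ∀ m k → 6 * (40 * m * (21 * k + 26)) ≡ 40 * (6 * m) * (21 * k + 26)
    reassociate = solve-∀
    expand : ∀ k → 40 * k * (21 * k + 26) + (24 * k * k + 3856 * k + 6936) ≡ 6 * ((12 * k + 34) * (12 * k + 34))
    expand = solve-∀
    scaled : 6 * (40 * m * (21 * k + 26)) < 6 * ((12 * k + 34) * (12 * k + 34))
    scaled = begin-strict
      6 * (40 * m * (21 * k + 26))                                  ≡⟨ reassociate m k ⟩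
      40 * (6 * m) * (21 * k + 26)                                  ≤⟨ *-monoˡ-≤ (21 * k + 26) (*-monoʳ-≤ 40 6m≤k) ⟩
      40 * k * (21 * k + 26)                                        <⟨ m<m+n (40 * k * (21 * k + 26)) (≤-trans (s≤s z≤n) (m≤n+m 6936 _)) ⟩
      40 * k * (21 * k + 26) + (24 * k * k + 3856 * k + 6936)       ≡⟨ expand k ⟩
      6 * ((12 * k + 34) * (12 * k + 34))                           ∎

  excess-margin : ∀ m k a b → 6 * m ≤ k → 2 + k ≤ b →
    40 * m * ((21 * k + 26) * (b * b)) < vertexForm k a b * vertexForm k a b
  excess-margin m k a b 6m≤k 2+k≤b = begin-strict
    40 * m * ((21 * k + 26) * (b * b))         ≡⟨ *-assoc (40 * m) (21 * k + 26) (b * b) ⟨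
    40 * m * (21 * k + 26) * (b * b)           <⟨ *-monoˡ-< (b * b) {{>-nonZero (*-mono-≤ 1≤b 1≤b)}} (coefficient-margin m k 6m≤k) ⟩
    (12 * k + 34) * (12 * k + 34) * (b * b)    ≡⟨ square-product (12 * k + 34) b ⟩
    (12 * k + 34) * b * ((12 * k + 34) * b)    ≤⟨ *-mono-≤ P-lower P-lower ⟩
    vertexForm k a b * vertexForm k a b        ∎
    where
    open ≤-Reasoning
    1≤b : 1 ≤ b
    1≤b = ≤-trans (s≤s z≤n) 2+k≤b
    P-lower : (12 * k + 34) * b ≤ vertexForm k a b
    P-lower = m≤n+m _ _
    square-product : ∀ c b → c * c * (b * b) ≡ c * b * (c * b)
    square-product = solve-∀

  sqrt5-gap-pos : ∀ k a b → 2 + k ≤ b → b * b ≤ a * a + a * b + 1 →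
    let P = vertexForm k a b; Q = deg3Form k a b in 121 * Q * Q + 16 * (P * P) < 5 * (P * P) + 88 * Q * P
  sqrt5-gap-pos k a b 2+k≤b cassini = +-cancelʳ-< (880 * deficit k b) R L shifted
    where
    open ≤-Reasoning
    P = vertexForm k a b
    Q = deg3Form k a b
    L = 5 * (P * P) + 88 * Q * P
    R = 121 * Q * Q + 16 * (P * P)
    shifted : R + 880 * deficit k b < L + 880 * deficit k b
    shifted = begin-strict
      R + 880 * deficit k b   <⟨ +-monoʳ-< R (*-monoʳ-< 880 (deficit<excess k a b 2+k≤b cassini)) ⟩
      R + 880 * excess k a b  ≡⟨ gap-identity k a b ⟨
      L + 880 * deficit k b   ∎

  sqrt5-gap-small : ∀ m k a b → a ≤ b → 2 + k ≤ b → a * a + a * b ≤ b * b + 1 → 6 * m ≤ k →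
    let P = vertexForm k a b; Q = deg3Form k a b in
    m * (5 * (P * P) + 88 * Q * P) < m * (121 * Q * Q + 16 * (P * P)) + 22 * (P * P)
  sqrt5-gap-small m k a b a≤b 2+k≤b cassini 6m≤k = +-cancelʳ-< (880 * (m * d)) (m * L) (m * R + 22 * (P * P)) shifted
    where
    open ≤-Reasoning
    P = vertexForm k a b
    Q = deg3Form k a b
    L = 5 * (P * P) + 88 * Q * P
    R = 121 * Q * Q + 16 * (P * P)
    d = deficit k b
    e = excess k a b
    c = (21 * k + 26) * (b * b)
    factor : ∀ m L d → m * L + 880 * (m * d) ≡ m * (L + 880 * d)
    factor = solve-∀
    expand : ∀ m R e → m * (R + 880 * e) ≡ m * R + 880 * (m * e)
    expand = solve-∀
    regroup : ∀ m R d c → m * R + 880 * (m * (d + c)) ≡ m * R + 22 * (40 * m * c) + 880 * (m * d)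
    regroup = solve-∀
    shifted : m * L + 880 * (m * d) < m * R + 22 * (P * P) + 880 * (m * d)
    shifted = begin-strict
      m * L + 880 * (m * d)                           ≡⟨ factor m L d ⟩
      m * (L + 880 * d)                               ≡⟨ cong (m *_) (gap-identity k a b) ⟩
      m * (R + 880 * e)                               ≡⟨ expand m R e ⟩
      m * R + 880 * (m * e)                           ≤⟨ +-monoʳ-≤ (m * R) (*-monoʳ-≤ 880 (*-monoʳ-≤ m (excess≤deficit+ k a b a≤b 2+k≤b cassini))) ⟩
      m * R + 880 * (m * (d + c))                     ≡⟨ regroup m R d c ⟩
      m * R + 22 * (40 * m * c) + 880 * (m * d)       <⟨ +-monoˡ-< (880 * (m * d)) (+-monoʳ-< (m * R) (*-monoʳ-< 22 (excess-margin m k a b 6m≤k 2+k≤b))) ⟩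
      m * R + 22 * (P * P) + 880 * (m * d)            ∎

  -- With r = 11 Q / P - 4 the three conditions say 1 ≤ r, r² < 5 and m (5 - r²) < 22.
  Sqrt5Approximation : ℕ → ℕ → ℕ → Set
  Sqrt5Approximation m P Q =
    5 * P ≤ 11 * Q ×
    121 * Q * Q + 16 * (P * P) < 5 * (P * P) + 88 * Q * P ×
    m * (5 * (P * P) + 88 * Q * P) < m * (121 * Q * Q + 16 * (P * P)) + 22 * (P * P)

  vertexForm-pos : ∀ k a b → 0 < b → 0 < vertexForm k a b
  vertexForm-pos k a b 0<b = ≤-trans (*-mono-≤ {1} {12 * k + 34} (≤-trans (s≤s z≤n) (m≤n+m 34 (12 * k))) 0<b) (m≤n+m _ _)

  V-pos : ∀ k → 0 < 5 * V (2 + k)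
  V-pos k = subst (0 <_) (sym (five-V k)) (vertexForm-pos k (fib (2 + k)) (fib (3 + k)) (fib-pos (2 + k)))

  V-D3-approximate-sqrt5 : ∀ k m → 5 ≤ k → 6 * m ≤ k → Sqrt5Approximation m (5 * V (2 + k)) (5 * D3 (2 + k))
  V-D3-approximate-sqrt5 k m 5≤k 6m≤k = subst₂ (Sqrt5Approximation m) (sym (five-V k)) (sym (five-D3 k))
    ( five-vertexForm≤eleven-deg3Form k a b 5≤k (fib-mono (1 + k))
    , sqrt5-gap-pos k a b (fib-linear k) (cassini-upper (2 + k))
    , sqrt5-gap-small m k a b (fib-mono (1 + k)) (fib-linear k) (cassini-lower (2 + k)) 6m≤k )
    where
    a = fib (2 + k)
    b = fib (3 + k)

module Approximation where

  open Estimates using (Sqrt5Approximation)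
  open import Data.Nat as ℕ using (ℕ; zero; suc)
  import Data.Nat.Properties as ℕ
  open import Data.Integer as ℤ using (+_; +<+; +≤+; +[1+_]; -[1+_])
  import Data.Integer.Properties as ℤ
  open import Data.Rational
  open import Data.Rational.Properties
  open import Data.Rational.Unnormalised as ℚᵘ using (mkℚᵘ; *≡*; *<*; *≤*)
  import Data.Rational.Unnormalised.Properties as ℚᵘ
  open import Data.Product using (_×_; _,_; proj₁; proj₂; ∃)
  open import Data.Sum using (inj₁; inj₂)
  open import Relation.Binary.PropositionalEquality
  open import Relation.Nullary using (yes; no)
  open import Data.Rational.Solver using (module +-*-Solver)

  ι : ℕ → ℚ
  ι n = + n / 1

  toℚᵘ-ι : ∀ n → toℚᵘ (ι n) ℚᵘ.≃ mkℚᵘ (+ n) 0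
  toℚᵘ-ι n = toℚᵘ-fromℚᵘ (mkℚᵘ (+ n) 0)

  ι-+ : ∀ m n → ι (m ℕ.+ n) ≡ ι m + ι n
  ι-+ m n = toℚᵘ-injective (begin
    toℚᵘ (ι (m ℕ.+ n))              ≈⟨ toℚᵘ-ι (m ℕ.+ n) ⟩
    mkℚᵘ (+ (m ℕ.+ n)) 0            ≈⟨ *≡* integral ⟩
    mkℚᵘ (+ m) 0 ℚᵘ.+ mkℚᵘ (+ n) 0  ≈⟨ ℚᵘ.+-cong (toℚᵘ-ι m) (toℚᵘ-ι n) ⟨
    toℚᵘ (ι m) ℚᵘ.+ toℚᵘ (ι n)      ≈⟨ toℚᵘ-homo-+ (ι m) (ι n) ⟨
    toℚᵘ (ι m + ι n)                ∎)
    where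
    open ℚᵘ.≃-Reasoning
    integral : + (m ℕ.+ n) ℤ.* + 1 ≡ (+ m ℤ.* + 1 ℤ.+ + n ℤ.* + 1) ℤ.* + 1
    integral = trans (ℤ.*-identityʳ _) (trans (ℤ.pos-+ m n)
      (sym (trans (ℤ.*-identityʳ _) (cong₂ ℤ._+_ (ℤ.*-identityʳ (+ m)) (ℤ.*-identityʳ (+ n))))))

  ι-* : ∀ m n → ι (m ℕ.* n) ≡ ι m * ι n
  ι-* m n = toℚᵘ-injective (begin
    toℚᵘ (ι (m ℕ.* n))              ≈⟨ toℚᵘ-ι (m ℕ.* n) ⟩
    mkℚᵘ (+ (m ℕ.* n)) 0            ≈⟨ *≡* integral ⟩
    mkℚᵘ (+ m) 0 ℚᵘ.* mkℚᵘ (+ n) 0  ≈⟨ ℚᵘ.*-cong (toℚᵘ-ι m) (toℚᵘ-ι n) ⟨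
    toℚᵘ (ι m) ℚᵘ.* toℚᵘ (ι n)      ≈⟨ toℚᵘ-homo-* (ι m) (ι n) ⟨
    toℚᵘ (ι m * ι n)                ∎)
    where
    open ℚᵘ.≃-Reasoning
    integral : + (m ℕ.* n) ℤ.* + 1 ≡ (+ m ℤ.* + n) ℤ.* + 1
    integral = cong (ℤ._* + 1) (ℤ.pos-* m n)

  ι-mono-< : ∀ {m n} → m ℕ.< n → ι m < ι n
  ι-mono-< {m} {n} m<n = toℚᵘ-cancel-< (ℚᵘ.<-respˡ-≃ (ℚᵘ.≃-sym (toℚᵘ-ι m)) (ℚᵘ.<-respʳ-≃ (ℚᵘ.≃-sym (toℚᵘ-ι n))
    (*<* (subst₂ ℤ._<_ (sym (ℤ.*-identityʳ (+ m))) (sym (ℤ.*-identityʳ (+ n))) (+<+ m<n)))))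

  ι-mono-≤ : ∀ {m n} → m ℕ.≤ n → ι m ≤ ι n
  ι-mono-≤ {m} {n} m≤n = toℚᵘ-cancel-≤ (ℚᵘ.≤-respˡ-≃ (ℚᵘ.≃-sym (toℚᵘ-ι m)) (ℚᵘ.≤-respʳ-≃ (ℚᵘ.≃-sym (toℚᵘ-ι n))
    (*≤* (subst₂ ℤ._≤_ (sym (ℤ.*-identityʳ (+ m))) (sym (ℤ.*-identityʳ (+ n))) (+≤+ m≤n)))))

  /-*-ι : ∀ d v .{{_ : ℕ.NonZero v}} → (+ d / v) * ι v ≡ ι d
  /-*-ι d v@(suc k) = toℚᵘ-injective (begin
    toℚᵘ ((+ d / v) * ι v)              ≈⟨ toℚᵘ-homo-* (+ d / v) (ι v) ⟩
    toℚᵘ (+ d / v) ℚᵘ.* toℚᵘ (ι v)      ≈⟨ ℚᵘ.*-cong (toℚᵘ-fromℚᵘ (mkℚᵘ (+ d) k)) (toℚᵘ-ι v) ⟩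
    mkℚᵘ (+ d) k ℚᵘ.* mkℚᵘ (+ v) 0      ≈⟨ *≡* integral ⟩
    mkℚᵘ (+ d) 0                        ≈⟨ toℚᵘ-ι d ⟨
    toℚᵘ (ι d)                          ∎)
    where
    open ℚᵘ.≃-Reasoning
    integral : (+ d ℤ.* + v) ℤ.* + 1 ≡ + d ℤ.* + (v ℕ.* 1)
    integral = trans (ℤ.*-identityʳ _) (cong (λ u → + d ℤ.* + u) (sym (ℕ.*-identityʳ v)))

  /-*-ι-scaled : ∀ c d v .{{_ : ℕ.NonZero v}} → (+ d / v) * ι (c ℕ.* v) ≡ ι (c ℕ.* d)
  /-*-ι-scaled c d v = begin
    (+ d / v) * ι (c ℕ.* v)    ≡⟨ cong ((+ d / v) *_) (ι-* c v) ⟩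
    (+ d / v) * (ι c * ι v)    ≡⟨ *-assoc (+ d / v) (ι c) (ι v) ⟨
    (+ d / v) * ι c * ι v      ≡⟨ cong (_* ι v) (*-comm (+ d / v) (ι c)) ⟩
    ι c * (+ d / v) * ι v      ≡⟨ *-assoc (ι c) (+ d / v) (ι v) ⟩
    ι c * ((+ d / v) * ι v)    ≡⟨ cong (ι c *_) (/-*-ι d v) ⟩
    ι c * ι d                  ≡⟨ ι-* c d ⟨
    ι (c ℕ.* d)                ∎
    where open ≡-Reasoning

  ι-nonNeg : ∀ n → NonNegative (ι n)
  ι-nonNeg n = nonNegative (ι-mono-≤ {0} {n} ℕ.z≤n)

  ι-square-nonNeg : ∀ n → NonNegative (ι n * ι n)
  ι-square-nonNeg n = subst NonNegative (ι-* n n) (ι-nonNeg (n ℕ.* n))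

  +-cancelʳ-< : ∀ c {p q} → p + c < q + c → p < q
  +-cancelʳ-< c {p} {q} p+c<q+c = subst₂ _<_ (cancel p) (cancel q) (+-monoˡ-< (- c) p+c<q+c)
    where
    open +-*-Solver using (solve; _:=_; _:+_; _:-_)
    cancel : ∀ x → x + c - c ≡ x
    cancel x = solve 2 (λ x c → x :+ c :- c := x) refl x c

  archimedean : ∀ ε → 0ℚ < ε → ∃ λ m → 1ℚ ≤ ι m * ε
  archimedean ε@(mkℚ +[1+ n ] d _) _ = suc d , (begin
    ι 1                            ≤⟨ ι-mono-≤ {1} {suc n} (ℕ.s≤s ℕ.z≤n) ⟩
    ι (suc n)                      ≡⟨ /-*-ι (suc n) (suc d) ⟨
    (+ suc n / suc d) * ι (suc d)  ≡⟨ cong (_* ι (suc d)) (↥p/↧p≡p ε) ⟩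
    ε * ι (suc d)                  ≡⟨ *-comm ε (ι (suc d)) ⟩
    ι (suc d) * ε                  ∎)
    where open ≤-Reasoning
  archimedean (mkℚ (+ zero) _ _) (*<* (+<+ ()))
  archimedean (mkℚ -[1+ _ ] _ _) (*<* ())

  sqrt5-bracket : ∀ r δ → 0ℚ < δ → 1ℚ ≤ r → r * r < ι 5 → ι 5 < r * r + (δ + δ) →
    LtSqrt5 (r - δ) × Sqrt5Lt (r + δ)
  sqrt5-bracket r δ 0<δ 1≤r r²<5 5<r²+2δ = below , 0<r+δ , above
    where
    open +-*-Solver using (solve; _:=_; _:+_; _:*_)
    0≤δ : 0ℚ ≤ δ
    0≤δ = <⇒≤ 0<δ
    0≤r : 0ℚ ≤ r
    0≤r = ≤-trans (ι-mono-≤ {0} {1} ℕ.z≤n) 1≤r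
    0<r+δ : 0ℚ < r + δ
    0<r+δ = +-mono-≤-< 0≤r 0<δ
    δ≤rδ : δ ≤ r * δ
    δ≤rδ = subst (_≤ r * δ) (*-identityˡ δ) (*-monoʳ-≤-nonNeg δ {{nonNegative 0≤δ}} 1≤r)
    0≤δδ : 0ℚ ≤ δ * δ
    0≤δδ = subst (_≤ δ * δ) (*-zeroˡ δ) (*-monoʳ-≤-nonNeg δ {{nonNegative 0≤δ}} 0≤δ)
    square-expand : (r + δ) * (r + δ) ≡ r * r + (r * δ + r * δ) + δ * δ
    square-expand = solve 2 (λ r δ → (r :+ δ) :* (r :+ δ) := r :* r :+ (r :* δ :+ r :* δ) :+ δ :* δ) refl r δ
    above : ι 5 < (r + δ) * (r + δ)
    above = begin-strict
      ι 5                                   <⟨ 5<r²+2δ ⟩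
      r * r + (δ + δ)                       ≡⟨ +-identityʳ _ ⟨
      r * r + (δ + δ) + 0ℚ                  ≤⟨ +-mono-≤ (+-monoʳ-≤ (r * r) (+-mono-≤ δ≤rδ δ≤rδ)) 0≤δδ ⟩
      r * r + (r * δ + r * δ) + δ * δ       ≡⟨ square-expand ⟨
      (r + δ) * (r + δ)                     ∎
      where open ≤-Reasoning
    below : LtSqrt5 (r - δ)
    below with r - δ <? 0ℚ
    ... | yes r-δ<0 = inj₁ r-δ<0
    ... | no  r-δ≮0 = inj₂ (≤-<-trans square-≤ r²<5)
      where
      0≤r-δ : 0ℚ ≤ r - δ
      0≤r-δ = ≮⇒≥ r-δ≮0
      r-δ≤r : r - δ ≤ r
      r-δ≤r = subst (r - δ ≤_) (+-identityʳ r) (+-monoʳ-≤ r (neg-antimono-≤ 0≤δ))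
      square-≤ : (r - δ) * (r - δ) ≤ r * r
      square-≤ = ≤-trans (*-monoʳ-≤-nonNeg (r - δ) {{nonNegative 0≤r-δ}} r-δ≤r)
                         (*-monoˡ-≤-nonNeg r {{nonNegative 0≤r}} r-δ≤r)

  square-11q-4 : ∀ q → (ι 11 * q - ι 4) * (ι 11 * q - ι 4) + ι 88 * q ≡ ι 121 * q * q + ι 16
  square-11q-4 q = begin
    (ι 11 * q - ι 4) * (ι 11 * q - ι 4) + ι 88 * q                    ≡⟨ cong (λ c → (ι 11 * q - ι 4) * (ι 11 * q - ι 4) + c * q) c88 ⟨
    (ι 11 * q - ι 4) * (ι 11 * q - ι 4) + (ι 11 * ι 4 + ι 11 * ι 4) * q ≡⟨ expand q (ι 11) (ι 4) ⟩
    ι 11 * ι 11 * q * q + ι 4 * ι 4                                     ≡⟨ cong₂ (λ c d → c * q * q + d) (ι-* 11 11) (ι-* 4 4) ⟨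
    ι 121 * q * q + ι 16                                                ∎
    where
    open ≡-Reasoning
    open +-*-Solver using (solve; _:=_; _:+_; _:*_; _:-_)
    c88 : ι 11 * ι 4 + ι 11 * ι 4 ≡ ι 88
    c88 = trans (cong₂ _+_ (sym (ι-* 11 4)) (sym (ι-* 11 4))) (sym (ι-+ 44 44))
    expand : ∀ q c f → (c * q - f) * (c * q - f) + (c * f + c * f) * q ≡ c * c * q * q + f * f
    expand = solve 3 (λ q c f → (c :* q :- f) :* (c :* q :- f) :+ (c :* f :+ c :* f) :* q := c :* c :* q :* q :+ f :* f) refl

  quadratic-form-ι : ∀ q P Q → q * ι P ≡ ι Q →
    (ι 121 * q * q + ι 16) * (ι P * ι P) ≡ ι (121 ℕ.* Q ℕ.* Q ℕ.+ 16 ℕ.* (P ℕ.* P))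
  quadratic-form-ι q P Q qP≡Q = begin
    (ι 121 * q * q + ι 16) * (ι P * ι P)                 ≡⟨ regroup (ι 121) (ι 16) q (ι P) ⟩
    ι 121 * (q * ι P) * (q * ι P) + ι 16 * (ι P * ι P)   ≡⟨ cong (λ x → ι 121 * x * x + ι 16 * (ι P * ι P)) qP≡Q ⟩
    ι 121 * ι Q * ι Q + ι 16 * (ι P * ι P)               ≡⟨ cong₂ _+_ (trans (ι-* (121 ℕ.* Q) Q) (cong (_* ι Q) (ι-* 121 Q)))
                                                                      (trans (ι-* 16 (P ℕ.* P)) (cong (ι 16 *_) (ι-* P P))) ⟨
    ι (121 ℕ.* Q ℕ.* Q) + ι (16 ℕ.* (P ℕ.* P))           ≡⟨ ι-+ (121 ℕ.* Q ℕ.* Q) (16 ℕ.* (P ℕ.* P)) ⟨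
    ι (121 ℕ.* Q ℕ.* Q ℕ.+ 16 ℕ.* (P ℕ.* P))             ∎
    where
    open ≡-Reasoning
    open +-*-Solver using (solve; _:=_; _:+_; _:*_)
    regroup : ∀ a b q v → (a * q * q + b) * (v * v) ≡ a * (q * v) * (q * v) + b * (v * v)
    regroup = solve 4 (λ a b q v → (a :* q :* q :+ b) :* (v :* v) := a :* (q :* v) :* (q :* v) :+ b :* (v :* v)) refl

  linear-form-ι : ∀ q P Q → q * ι P ≡ ι Q →
    (ι 5 + ι 88 * q) * (ι P * ι P) ≡ ι (5 ℕ.* (P ℕ.* P) ℕ.+ 88 ℕ.* Q ℕ.* P)
  linear-form-ι q P Q qP≡Q = begin
    (ι 5 + ι 88 * q) * (ι P * ι P)                ≡⟨ regroup (ι 5) (ι 88) q (ι P) ⟩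
    ι 5 * (ι P * ι P) + ι 88 * (q * ι P) * ι P    ≡⟨ cong (λ x → ι 5 * (ι P * ι P) + ι 88 * x * ι P) qP≡Q ⟩
    ι 5 * (ι P * ι P) + ι 88 * ι Q * ι P          ≡⟨ cong₂ _+_ (trans (ι-* 5 (P ℕ.* P)) (cong (ι 5 *_) (ι-* P P)))
                                                               (trans (ι-* (88 ℕ.* Q) P) (cong (_* ι P) (ι-* 88 Q))) ⟨
    ι (5 ℕ.* (P ℕ.* P)) + ι (88 ℕ.* Q ℕ.* P)      ≡⟨ ι-+ (5 ℕ.* (P ℕ.* P)) (88 ℕ.* Q ℕ.* P) ⟨
    ι (5 ℕ.* (P ℕ.* P) ℕ.+ 88 ℕ.* Q ℕ.* P)        ∎
    where
    open ≡-Reasoning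
    open +-*-Solver using (solve; _:=_; _:+_; _:*_)
    regroup : ∀ a b q v → (a + b * q) * (v * v) ≡ a * (v * v) + b * (q * v) * v
    regroup = solve 4 (λ a b q v → (a :+ b :* q) :* (v :* v) := a :* (v :* v) :+ b :* (q :* v) :* v) refl

  1≤11q-4 : ∀ q P Q → 0 ℕ.< P → q * ι P ≡ ι Q → 5 ℕ.* P ℕ.≤ 11 ℕ.* Q → 1ℚ ≤ ι 11 * q - ι 4
  1≤11q-4 q P Q 0<P qP≡Q 5P≤11Q =
    +-monoˡ-≤ (- ι 4) {ι 5} {ι 11 * q} (*-cancelʳ-≤-pos {ι 5} {ι 11 * q} (ι P) {{positive (ι-mono-< 0<P)}} (begin
    ι 5 * ι P         ≡⟨ ι-* 5 P ⟨
    ι (5 ℕ.* P)       ≤⟨ ι-mono-≤ 5P≤11Q ⟩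
    ι (11 ℕ.* Q)      ≡⟨ ι-* 11 Q ⟩
    ι 11 * ι Q        ≡⟨ cong (ι 11 *_) qP≡Q ⟨
    ι 11 * (q * ι P)  ≡⟨ *-assoc (ι 11) q (ι P) ⟨
    ι 11 * q * ι P    ∎))
    where open ≤-Reasoning

  quadratic<linear : ∀ q P Q → q * ι P ≡ ι Q →
    121 ℕ.* Q ℕ.* Q ℕ.+ 16 ℕ.* (P ℕ.* P) ℕ.< 5 ℕ.* (P ℕ.* P) ℕ.+ 88 ℕ.* Q ℕ.* P →
    ι 121 * q * q + ι 16 < ι 5 + ι 88 * q
  quadratic<linear q P Q qP≡Q gap = *-cancelʳ-<-nonNeg (ι P * ι P) {{ι-square-nonNeg P}}
    (subst₂ _<_ (sym (quadratic-form-ι q P Q qP≡Q)) (sym (linear-form-ι q P Q qP≡Q)) (ι-mono-< gap))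

  linear<quadratic+22ε : ∀ q ε m P Q → 1ℚ ≤ ι m * ε → q * ι P ≡ ι Q →
    m ℕ.* (5 ℕ.* (P ℕ.* P) ℕ.+ 88 ℕ.* Q ℕ.* P) ℕ.< m ℕ.* (121 ℕ.* Q ℕ.* Q ℕ.+ 16 ℕ.* (P ℕ.* P)) ℕ.+ 22 ℕ.* (P ℕ.* P) →
    ι 5 + ι 88 * q < ι 121 * q * q + ι 16 + ι 22 * ε
  linear<quadratic+22ε q ε m P Q 1≤mε qP≡Q gap = *-cancelʳ-<-nonNeg w {{w-nonNeg}} (begin-strict
    (ι 5 + ι 88 * q) * w                                   ≡⟨ pull-out (ι 5 + ι 88 * q) ⟩
    ι m * ((ι 5 + ι 88 * q) * v²)                          ≡⟨ cong (ι m *_) (linear-form-ι q P Q qP≡Q) ⟩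
    ι m * ι L                                              ≡⟨ ι-* m L ⟨
    ι (m ℕ.* L)                                            <⟨ ι-mono-< gap ⟩
    ι (m ℕ.* R ℕ.+ 22 ℕ.* (P ℕ.* P))                       ≡⟨ trans (ι-+ (m ℕ.* R) _) (cong₂ _+_ (ι-* m R) (trans (ι-* 22 (P ℕ.* P)) (cong (ι 22 *_) (ι-* P P)))) ⟩
    ι m * ι R + ι 22 * v²                                  ≡⟨ cong₂ (λ x y → ι m * x + y) (quadratic-form-ι q P Q qP≡Q) (*-identityˡ (ι 22 * v²)) ⟨
    ι m * ((ι 121 * q * q + ι 16) * v²) + 1ℚ * (ι 22 * v²) ≤⟨ +-monoʳ-≤ (ι m * ((ι 121 * q * q + ι 16) * v²)) (*-monoʳ-≤-nonNeg (ι 22 * v²) {{22v²-nonNeg}} 1≤mε) ⟩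
    ι m * ((ι 121 * q * q + ι 16) * v²) + ι m * ε * (ι 22 * v²) ≡⟨ collect (ι 121 * q * q + ι 16) ⟩
    (ι 121 * q * q + ι 16 + ι 22 * ε) * w                  ∎)
    where
    open ≤-Reasoning
    open +-*-Solver using (solve; _:=_; _:+_; _:*_)
    L = 5 ℕ.* (P ℕ.* P) ℕ.+ 88 ℕ.* Q ℕ.* P
    R = 121 ℕ.* Q ℕ.* Q ℕ.+ 16 ℕ.* (P ℕ.* P)
    v² = ι P * ι P
    w = ι m * v²
    w-nonNeg : NonNegative w
    w-nonNeg = nonNeg*nonNeg⇒nonNeg (ι m) {{ι-nonNeg m}} v² {{ι-square-nonNeg P}}
    22v²-nonNeg : NonNegative (ι 22 * v²)
    22v²-nonNeg = nonNeg*nonNeg⇒nonNeg (ι 22) {{ι-nonNeg 22}} v² {{ι-square-nonNeg P}}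
    pull-out : ∀ x → x * w ≡ ι m * (x * v²)
    pull-out x = solve 3 (λ x M y → x :* (M :* y) := M :* (x :* y)) refl x (ι m) v²
    collect : ∀ x → ι m * (x * v²) + ι m * ε * (ι 22 * v²) ≡ (x + ι 22 * ε) * w
    collect x = solve 5 (λ x M e c y → M :* (x :* y) :+ M :* e :* (c :* y) := (x :+ c :* e) :* (M :* y)) refl x (ι m) ε (ι 22) v²

  sqrt5-approximation⇒closeToL : ∀ q ε m P Q → 0ℚ < ε → 1ℚ ≤ ι m * ε → 0 ℕ.< P → q * ι P ≡ ι Q →
    Sqrt5Approximation m P Q → CloseToL q ε
  sqrt5-approximation⇒closeToL q ε m P Q 0<ε 1≤mε 0<P qP≡Q (5P≤11Q , gap-pos , gap-small) =
    subst LtSqrt5 (sym lower≡) (proj₁ bracket) , subst Sqrt5Lt (sym upper≡) (proj₂ bracket)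
    where
    open ≡-Reasoning
    open +-*-Solver using (solve; _:=_; _:+_; _:*_; _:-_)
    r = ι 11 * q - ι 4
    δ = ι 11 * ε
    0<δ : 0ℚ < δ
    0<δ = subst (_< δ) (*-zeroʳ (ι 11)) (*-monoʳ-<-pos (ι 11) {{positive (ι-mono-< {0} {11} (ℕ.s≤s ℕ.z≤n))}} 0<ε)
    r²<5 : r * r < ι 5
    r²<5 = +-cancelʳ-< (ι 88 * q) (subst (_< ι 5 + ι 88 * q) (sym (square-11q-4 q)) (quadratic<linear q P Q qP≡Q gap-pos))
    2δ≡22ε : δ + δ ≡ ι 22 * ε
    2δ≡22ε = trans (sym (*-distribʳ-+ ε (ι 11) (ι 11))) (cong (_* ε) (sym (ι-+ 11 11)))
    5<r²+2δ : ι 5 < r * r + (δ + δ)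
    5<r²+2δ = +-cancelʳ-< (ι 88 * q) (subst (ι 5 + ι 88 * q <_) (begin
      ι 121 * q * q + ι 16 + ι 22 * ε     ≡⟨ cong₂ _+_ (square-11q-4 q) 2δ≡22ε ⟨
      r * r + ι 88 * q + (δ + δ)          ≡⟨ solve 3 (λ x y z → x :+ y :+ z := x :+ z :+ y) refl (r * r) (ι 88 * q) (δ + δ) ⟩
      r * r + (δ + δ) + ι 88 * q          ∎) (linear<quadratic+22ε q ε m P Q 1≤mε qP≡Q gap-small))
    bracket : LtSqrt5 (r - δ) × Sqrt5Lt (r + δ)
    bracket = sqrt5-bracket r δ 0<δ (1≤11q-4 q P Q 0<P qP≡Q 5P≤11Q) r²<5 5<r²+2δ
    lower≡ : ι 11 * (q - ε) - ι 4 ≡ r - δ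
    lower≡ = solve 4 (λ q ε c f → c :* (q :- ε) :- f := (c :* q :- f) :- c :* ε) refl q ε (ι 11) (ι 4)
    upper≡ : ι 11 * (q + ε) - ι 4 ≡ r + δ
    upper≡ = solve 4 (λ q ε c f → c :* (q :+ ε) :- f := (c :* q :- f) :+ c :* ε) refl q ε (ι 11) (ι 4)

open Estimates using (V-pos; V-D3-approximate-sqrt5)
open Approximation using (archimedean; sqrt5-approximation⇒closeToL; /-*-ι-scaled)
open import Data.Nat using (ℕ; suc; _≥_; NonZero; s≤s; _+_; _*_; >-nonZero)
open import Data.Nat.Properties using (≤-trans; m≤m+n; m≤n+m; m*n≢0⇒n≢0)
open import Data.Integer using (+_)
open import Data.Rational using (ℚ; _<_; _/_; 0ℚ)
open import Data.Product using (Σ; ∃; _,_; proj₁; proj₂)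

theorem3p10 : (ε : ℚ) → 0ℚ < ε →
    ∃ λ N → (n : ℕ) → n ≥ N →
      Σ (NonZero (V n)) λ nz → CloseToL (((+ D3 n) / V n) {{nz}}) ε
theorem3p10 ε 0<ε = 7 + 6 * m , eventually
  where
  -- A `with` on archimedean would normalise the goal while abstracting, unfolding V n.
  m : ℕ
  m = proj₁ (archimedean ε 0<ε)
  eventually : (n : ℕ) → n ≥ 7 + 6 * m → Σ (NonZero (V n)) λ nz → CloseToL (((+ D3 n) / V n) {{nz}}) ε
  eventually (suc (suc k)) (s≤s (s≤s 5+6m≤k)) =
    nz , sqrt5-approximation⇒closeToL (+ D3 (2 + k) / V (2 + k)) ε m (5 * V (2 + k)) (5 * D3 (2 + k))
           0<ε (proj₂ (archimedean ε 0<ε)) (V-pos k) (/-*-ι-scaled 5 (D3 (2 + k)) (V (2 + k)))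
           (V-D3-approximate-sqrt5 k m (≤-trans (m≤m+n 5 (6 * m)) 5+6m≤k) (≤-trans (m≤n+m (6 * m) 5) 5+6m≤k))
    where
    instance
      nz : NonZero (V (2 + k))
      nz = m*n≢0⇒n≢0 5 {{>-nonZero (V-pos k)}}
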